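{- Let $P$ be a $\mathrm{CCS}^{ - }_{\mathrm{core}}$ process that is not divergent, and suppose $P\xrightarrow{\tau}P'$. Then $P\not\sim P'$.
   Context: $\mathrm{CCS}^{ - }_{\mathrm{core}}$ has processes $P,Q ::= 0 \mid a.P \mid \overline{a}.P \mid P\,|\,Q \mid\ !P$. Actions: $a$, $\overline a$, $\tau$. Transition rules: $a.P\xrightarrow{a}P$; $\overline{a}.P\xrightarrow{\overline a}P$; if $P\xrightarrow{\alpha}P'$ then $P|Q\xrightarrow{\alpha}P'|Q$ and $Q|P\xrightarrow{\alpha}Q|P'$; if $P\xrightarrow{\overline a}P'$, $Q\xrightarrow{a}Q'$ then $P|Q\xrightarrow{\tau}P'|Q'$ and $Q|P\xrightarrow{\tau}Q'|P'$; if $P\xrightarrow{\alpha}P'$ then $!P\xrightarrow{\alpha}P'|\,!P$; if $P\xrightarrow{a}P'$ and $P\xrightarrow{\overline a}P''$ then $!P\xrightarrow{\tau}P'|P''|\,!P$. $P$ is divergent if it has an infinite $\tau$-sequence; $\mathcal R$ is divergence-sensitive if $P\mathcal RQ$ implies ($P$ divergent iff $Q$ divergent). A strong bisimulation is a symmetric divergence-sensitive relation $\mathcal R$ such that $P\mathcal RQ$, $P\xrightarrow{\alpha}P'$ imply $Q\xrightarrow{\alpha}Q'$ with $P'\mathcal RQ'$; $\sim$ is the union of all strong bisimulations. -}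

module Defs where

open import Data.Nat using (ℕ; suc)
open import Data.Product using (Σ; ∃; _×_; _,_)
open import Relation.Binary.PropositionalEquality using (_≡_)

Name : Set
Name = ℕ

data Proc : Set where
  𝟎    : Proc
  inp  : Name → Proc → Proc
  out  : Name → Proc → Proc
  _∣_  : Proc → Proc → Proc
  !_   : Proc → Proc

infixl 5 _∣_
infix 7 !_

data Act : Set where
  inA  : Name → Act
  outA : Name → Act
  τ    : Act

data _—[_]→_ : Proc → Act → Proc → Set where
  t-inp  : ∀ {a P} → inp a P —[ inA a ]→ P
  t-out  : ∀ {a P} → out a P —[ outA a ]→ P
  t-parL : ∀ {P P' Q α} → P —[ α ]→ P' → (P ∣ Q) —[ α ]→ (P' ∣ Q)
  t-parR : ∀ {P P' Q α} → P —[ α ]→ P' → (Q ∣ P) —[ α ]→ (Q ∣ P')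
  t-comL : ∀ {P P' Q Q' a} → P —[ outA a ]→ P' → Q —[ inA a ]→ Q' →
           (P ∣ Q) —[ τ ]→ (P' ∣ Q')
  t-comR : ∀ {P P' Q Q' a} → P —[ outA a ]→ P' → Q —[ inA a ]→ Q' →
           (Q ∣ P) —[ τ ]→ (Q' ∣ P')
  t-rep  : ∀ {P P' α} → P —[ α ]→ P' → (! P) —[ α ]→ (P' ∣ ! P)
  t-repC : ∀ {P P' P'' a} → P —[ inA a ]→ P' → P —[ outA a ]→ P'' →
           (! P) —[ τ ]→ (P' ∣ P'' ∣ ! P)

Divergent : Proc → Set
Divergent P = Σ (ℕ → Proc) λ f → (f 0 ≡ P) × (∀ i → f i —[ τ ]→ f (suc i))

Rel : Set₁
Rel = Proc → Proc → Set

Symmetric : Rel → Set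
Symmetric R = ∀ {P Q} → R P Q → R Q P

DivergenceSensitive : Rel → Set
DivergenceSensitive R =
  ∀ {P Q} → R P Q → (Divergent P → Divergent Q) × (Divergent Q → Divergent P)

Simulation : Rel → Set
Simulation R = ∀ {P Q α P'} → R P Q → P —[ α ]→ P' →
  Σ Proc λ Q' → (Q —[ α ]→ Q') × R P' Q'

record StrongBisimulation (R : Rel) : Set where
  field
    sym      : Symmetric R
    divSens  : DivergenceSensitive R
    simulate : Simulation R

_∼_ : Proc → Proc → Set₁
P ∼ Q = Σ Rel λ R → StrongBisimulation R × R P Q

module Submission where

open import Data.Nat using (ℕ; zero; suc)
open import Data.Product using (_,_)
open import Relation.Binary.PropositionalEquality using (refl)
open import Relation.Nullary using (¬_)

open import Defs

-- If R P P' and P —τ→ P', simulating that step gives P' —τ→ P'' with R P' P'',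
-- and the argument repeats forever: P —τ→ P' —τ→ P'' —τ→ ⋯ is an infinite τ-run.

record RelatedτStep (R : Rel) : Set where
  constructor relatedτStep
  field
    source target : Proc
    related       : R source target
    step          : source —[ τ ]→ target

module _ {R : Rel} (simulate : Simulation R) where
  open RelatedτStep

  nextRelatedτStep : RelatedτStep R → RelatedτStep R
  nextRelatedτStep s =
    let (target' , step' , related') = simulate (related s) (step s)
    in  relatedτStep (target s) target' related' step'

  iterateRelatedτStep : RelatedτStep R → ℕ → RelatedτStep R
  iterateRelatedτStep s zero    = s
  iterateRelatedτStep s (suc n) = nextRelatedτStep (iterateRelatedτStep s n)

  relatedτStep⇒divergent : ∀ {P P'} → R P P' → P —[ τ ]→ P' → Divergent P
  relatedτStep⇒divergent r t =
    (λ i → source (run i)) , refl , λ i → step (run i)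
    where
      run : ℕ → RelatedτStep R
      run = iterateRelatedτStep (relatedτStep _ _ r t)

corollary13 : ∀ {P P'} → ¬ Divergent P → P —[ τ ]→ P' → ¬ (P ∼ P')
corollary13 ¬div t (R , bisim , r) =
  ¬div (relatedτStep⇒divergent (StrongBisimulation.simulate bisim) r t)
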